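{- For every $\phi\in\mathcal{L}_{ELKy^r}$ and every $\langle\Gamma,F,\vec{f}\rangle\in W^c$: $(\mathfrak{M}^c,\langle\Gamma,F,\vec{f}\rangle)\models\phi$ if and only if $\phi\in\Gamma$.
   Context: $\mathcal{L}_{ELKy^r}$: $\phi ::= p\mid\neg\phi\mid(\phi\land\phi)\mid K_a\phi\mid Ky_a^r(\phi,\phi)$ over a countably infinite set of atoms $\mathcal{P}$ and countable set of agents $\mathcal{A}$. $\Lambda\subseteq\mathcal{L}_{ELKy^r}$ is a fixed set (tautology ground). $\mathbb{SKYR}$ is the Hilbert system with axioms (PT) propositional tautologies; (K) $K_a(\phi\to\psi)\to(K_a\phi\to K_a\psi)$; (T) $K_a\phi\to\phi$; (4) $K_a\phi\to K_aK_a\phi$; (5) $\neg K_a\phi\to K_a\neg K_a\phi$; (EKyR) $Ky_a^r(\chi,\phi\to\psi)\to(Ky_a^r(\theta,\phi)\to Ky_a^r(\chi\land\theta,\psi))$; (4YKR) $Ky_a^r(\phi,\psi)\to K_aKy_a^r(\phi,\psi)$; (DKyR) $Ky_a^r(\phi,\psi)\to K_a(\phi\to\psi)$; (IKyR) $Ky_a^r(\psi,\chi)\to(K_a(\phi\to\psi)\to Ky_a^r(\phi,\chi))$; (UKyR) $K_a\neg\phi\to Ky_a^r(\phi,\psi)$; rules (MP), (NK), (NKyR) from $\phi\in\Lambda$ infer $\vdash Ky_a^r(\top,\phi)$; maximal consistent sets as usual. Canonical model $\mathfrak{M}^c=\langle W^c,E^c,\{R^c_a\},\mathcal{E}^c,V^c\rangle$: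 $\hat{E}^c$ is the set of terms $t::=e\mid\phi\mid(t\cdot t)$ with $\phi\in\mathcal{L}_{ELKy^r}$; $E^c=\{e_\top\}\cup\{t_\phi\mid t\in\hat{E}^c\setminus\{e\},\phi\in\mathcal{L}_{ELKy^r}\}$, with $t_\phi\cdot s_\psi:=(t\cdot s)_{\phi\land\psi}$ ($e_\top$ read as $t=e,\phi=\top$). $W^c$ is the set of triples $\langle\Gamma,F,\vec{f}\rangle$ with $\Gamma$ maximal consistent, $F\subseteq E^c\times\mathcal{L}_{ELKy^r}$, $\vec{f}=(f^\phi_a)_{a,\phi}$ with $f^\phi_a:\{\psi\mid Ky_a^r(\phi,\psi)\in\Gamma\}\to E^c$, such that: (1) $(s_\alpha,\phi\to\psi),(r_\beta,\phi)\in F$ implies $((s\cdot r)_{\alpha\land\beta},\psi)\in F$; (2) $\phi\in\Lambda$ implies $(e_\top,\phi)\in F$; (3) if $Ky_a^r(\phi,\psi)\land\phi\in\Gamma$ then $(f_a^\phi(\psi),\psi)\in F$; (4) each $f_a^\phi(\psi)$ is of the form $t_\phi$ with $t\in\hat{E}^c$. $R^c_a$ relates $\langle\Gamma,F,\vec f\rangle$ to $\langle\Delta,G,\vec g\rangle$ iff $\{\phi\mid K_a\phi\in\Gamma\}\subseteq\Delta$ and $f^\phi_a=g^\phi_a$ for all $\phi$; $\mathcal{E}^c(t_\phi,\psi)=\{\langle\Gamma,F,\vec f\rangle\mid(t_\phi,\psi)\in F\}$; $V^c(p)=\{\langle\Gamma,F,\vec f\rangle\mid p\in\Gamma\}$.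 Truth: $p,\neg,\land$ as usual; $K_a\phi$ holds at $w$ iff $\phi$ holds at all $R^c_a$-successors; $Ky_a^r(\phi,\psi)$ holds at $w$ iff there is $t\in E^c$ such that every $v$ with $(w,v)\in R^c_a$ and $v\models\phi$ satisfies $v\in\mathcal{E}^c(t,\psi)$ and $v\models\psi$. -}

module Defs where

open import Data.Nat using (ℕ)
open import Data.Bool using (Bool; true; false; not; _∧_)
open import Data.List using (List; []; _∷_)
open import Data.List.Relation.Unary.All using (All)
open import Data.Product using (Σ; _×_)
open import Data.Sum using (_⊎_)
open import Data.Empty using (⊥)
open import Relation.Nullary using (¬_)
open import Relation.Binary.PropositionalEquality using (_≡_)
open import Level using (Lift; suc; zero)

module Syntax (Agt : Set) where

  infixr 6 _∧'_
  infixr 5 _⇒_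

  data Form : Set where
    atom : ℕ → Form
    ¬'   : Form → Form
    _∧'_ : Form → Form → Form
    K    : Agt → Form → Form
    Ky   : Agt → Form → Form → Form

  _⇒_ : Form → Form → Form
  φ ⇒ ψ = ¬' (φ ∧' ¬' ψ)

  ⊤' : Form
  ⊤' = ¬' (atom 0 ∧' ¬' (atom 0))

  ⊥' : Form
  ⊥' = ¬' ⊤'

  peval : (Form → Bool) → Form → Bool
  peval v (atom p)   = v (atom p)
  peval v (¬' φ)     = not (peval v φ)
  peval v (φ ∧' ψ)   = peval v φ ∧ peval v ψ
  peval v (K a φ)    = v (K a φ)
  peval v (Ky a φ ψ) = v (Ky a φ ψ)

  Taut : Form → Set
  Taut φ = (v : Form → Bool) → peval v φ ≡ true

  conj : List Form → Form
  conj []       = ⊤'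
  conj (φ ∷ φs) = φ ∧' conj φs

module Logic (Agt : Set) (Λ : Syntax.Form Agt → Set) where
  open Syntax Agt

  data ⊢_ : Form → Set where
    PT    : ∀ {φ} → Taut φ → ⊢ φ
    AxK   : ∀ {a φ ψ} → ⊢ (K a (φ ⇒ ψ) ⇒ (K a φ ⇒ K a ψ))
    AxT   : ∀ {a φ} → ⊢ (K a φ ⇒ φ)
    Ax4   : ∀ {a φ} → ⊢ (K a φ ⇒ K a (K a φ))
    Ax5   : ∀ {a φ} → ⊢ (¬' (K a φ) ⇒ K a (¬' (K a φ)))
    EKyR  : ∀ {a χ θ φ ψ} →
            ⊢ (Ky a χ (φ ⇒ ψ) ⇒ (Ky a θ φ ⇒ Ky a (χ ∧' θ) ψ))
    4YKR  : ∀ {a φ ψ} → ⊢ (Ky a φ ψ ⇒ K a (Ky a φ ψ))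
    DKyR  : ∀ {a φ ψ} → ⊢ (Ky a φ ψ ⇒ K a (φ ⇒ ψ))
    IKyR  : ∀ {a φ ψ χ} → ⊢ (Ky a ψ χ ⇒ (K a (φ ⇒ ψ) ⇒ Ky a φ χ))
    UKyR  : ∀ {a φ ψ} → ⊢ (K a (¬' φ) ⇒ Ky a φ ψ)
    MP    : ∀ {φ ψ} → ⊢ (φ ⇒ ψ) → ⊢ φ → ⊢ ψ
    NK    : ∀ {a φ} → ⊢ φ → ⊢ K a φ
    NKyR  : ∀ {a φ} → Λ φ → ⊢ Ky a ⊤' φ

  Consistent : (Form → Set) → Set
  Consistent Γ = ¬ (Σ (List Form) λ φs → All Γ φs × (⊢ (conj φs ⇒ ⊥')))

  MCS : (Form → Set) → Set
  MCS Γ = Consistent Γ ×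
          ((φ : Form) → Consistent (λ ψ → Γ ψ ⊎ ψ ≡ φ) → Γ φ)

module Canonical (Agt : Set) (Λ : Syntax.Form Agt → Set) where
  open Syntax Agt
  open Logic Agt Λ

  data Term : Set where
    e   : Term
    fm  : Form → Term
    _·_ : Term → Term → Term

  -- E^c = { e_⊤ } ∪ { t_φ | t ∈ \hat{E}^c ∖ {e}, φ ∈ L }
  -- (t ∖ {e} : t is either a formula term or a product)
  data Ev : Set where
    e⊤   : Ev
    evF  : Form → Form → Ev            -- (fm χ)_φ
    evM  : Term → Term → Form → Ev     -- (t · s)_φ

  term : Ev → Term
  term e⊤           = e
  term (evF χ φ)  = fm χ
  term (evM t s φ) = t · s

  label : Ev → Form
  label e⊤           = ⊤'
  label (evF χ φ)  = φ
  label (evM t s φ) = φ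

  _∙_ : Ev → Ev → Ev
  x ∙ y = evM (term x) (term y) (label x ∧' label y)

  record World : Set₁ where
    field
      Γ   : Form → Set
      mcs : MCS Γ
      F   : Ev → Form → Set
      -- f^φ_a : {ψ | Ky_a(φ,ψ) ∈ Γ} → E^c
      f   : (a : Agt) (φ ψ : Form) → .(Γ (Ky a φ ψ)) → Ev
      c1  : ∀ s r φ ψ → F s (φ ⇒ ψ) → F r φ → F (s ∙ r) ψ
      c2  : ∀ φ → Λ φ → F e⊤ φ
      c3  : ∀ a φ ψ (p : Γ (Ky a φ ψ)) → Γ (Ky a φ ψ ∧' φ) →
            F (f a φ ψ p) ψ
      c4  : ∀ a φ ψ (p : Γ (Ky a φ ψ)) → label (f a φ ψ p) ≡ φ
  open World public

  R : Agt → World → World → Set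
  R a w v =
    (∀ φ → Γ w (K a φ) → Γ v φ) ×
    (∀ φ ψ → (Γ w (Ky a φ ψ) → Γ v (Ky a φ ψ)) ×
             (Γ v (Ky a φ ψ) → Γ w (Ky a φ ψ))) ×
    (∀ φ ψ (p : Γ w (Ky a φ ψ)) (q : Γ v (Ky a φ ψ)) →
       f w a φ ψ p ≡ f v a φ ψ q)

  𝓔 : Ev → Form → World → Set
  𝓔 t ψ w = F w t ψ

  _⊨_ : World → Form → Set₁
  w ⊨ atom p   = Lift (suc zero) (Γ w (atom p))
  w ⊨ ¬' φ     = ¬ (w ⊨ φ)
  w ⊨ (φ ∧' ψ) = (w ⊨ φ) × (w ⊨ ψ)
  w ⊨ K a φ    = ∀ v → R a w v → v ⊨ φ
  w ⊨ Ky a φ ψ = Σ Ev λ t → ∀ v → R a w v → v ⊨ φ →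
                   Lift (suc zero) (𝓔 t ψ v) × (v ⊨ ψ)

-- In the modal cases,
-- membership implies truth directly: for K by the definition of R, for Ky via the
-- shared evidence function f and condition (3), with (DKyR).  For the converse we
-- use the existence lemma (`Successor`): if agent a considers θ possible at w, then
-- Lindenbaum's lemma extends {χ | K_a χ ∈ Γ} ∪ {θ} to a maximal consistent set,
-- which becomes an a-successor v of w once its evidence is generated freely from
-- the Ky-formulas it contains.  Other agents' evidence is labelled by a formula
-- not occurring in the evidence term t at hand, so t is backed at w by a formula
-- Ky_a(label t, ψ) (`evidence-origin`); axioms (UKyR) and (IKyR) then contradict
-- the assumption Ky_a(φ, ψ) ∉ Γ.
--
-- Membership in a maximal consistent set is ¬¬-stable.

module Submission where

open import Defs
open import Data.Nat using (ℕ)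
open import Data.Product using (_×_)
open import Function.Bundles using (_↣_)
open import Level using (0ℓ)
open import Axiom.ExcludedMiddle using (ExcludedMiddle)

open import Data.Nat using (zero; suc; _+_; _<_; s≤s; _≤′_; ≤′-reflexive; ≤′-step; _⊔_)
open import Data.Nat.Properties
  using (suc-injective; <-irrefl; <-trans; ≤-refl; m≤m+n; m≤n+m; ≤⇒≤′; m≤m⊔n; m≤n⊔m; eq?)
open import Data.Bool using (Bool; true; false; not; _∧_; T)
open import Data.Bool.Properties using (T-∧; T-≡)
open import Data.Fin using (Fin) renaming (zero to fz; suc to fs)
open import Data.Vec using (Vec; []; _∷_; lookup) renaming (map to mapᵛ)
open import Data.Vec.Properties using (lookup-map)
open import Data.List using (List; []; _∷_; _++_)
open import Data.List.Relation.Unary.All using (All; []; _∷_) renaming (map to mapᴬ)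
open import Data.List.Relation.Unary.All.Properties using (++⁺)
open import Data.Product using (Σ; _,_; proj₁; proj₂)
open import Data.Sum using (_⊎_; inj₁; inj₂)
open import Data.Unit using (⊤)
open import Data.Empty using (⊥-elim)
open import Function using (_∘′_)
open import Function.Bundles using (Equivalence; Injection)
open import Level using (lift; lower)
open import Relation.Nullary using (¬_; yes; no)
open import Relation.Binary.PropositionalEquality
  using (_≡_; _≢_; refl; sym; trans; cong; cong₂; subst)

-- Propositional tautologies, proved by evaluating schemata on all assignments.
module Schemata (Agt : Set) (Λ : Syntax.Form Agt → Set) where
  open Syntax Agt
  open Logic Agt Λ

  infix  7 ¬ₛ_
  infixr 6 _∧ₛ_
  infixr 5 _⇒ₛ_

  data Schema (n : ℕ) : Set where
    var  : Fin n → Schema n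
    ¬ₛ_  : Schema n → Schema n
    _∧ₛ_ : Schema n → Schema n → Schema n

  _⇒ₛ_ : ∀ {n} → Schema n → Schema n → Schema n
  s ⇒ₛ t = ¬ₛ (s ∧ₛ ¬ₛ t)

  -- The schemata instantiating to ⊤' and ⊥' when their variable is instantiated by atom 0.
  ⊤ₛ ⊥ₛ : ∀ {n} → Schema n → Schema n
  ⊤ₛ s = ¬ₛ (s ∧ₛ ¬ₛ s)
  ⊥ₛ s = ¬ₛ ⊤ₛ s

  x₀ : ∀ {n} → Schema (suc n)
  x₀ = var fz
  x₁ : ∀ {n} → Schema (suc (suc n))
  x₁ = var (fs fz)
  x₂ : ∀ {n} → Schema (suc (suc (suc n)))
  x₂ = var (fs (fs fz))
  x₃ : ∀ {n} → Schema (suc (suc (suc (suc n))))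
  x₃ = var (fs (fs (fs fz)))
  x₄ : ∀ {n} → Schema (suc (suc (suc (suc (suc n)))))
  x₄ = var (fs (fs (fs (fs fz))))

  instantiate : ∀ {n} → Schema n → Vec Form n → Form
  instantiate (var i)  σ = lookup σ i
  instantiate (¬ₛ s)   σ = ¬' (instantiate s σ)
  instantiate (s ∧ₛ t) σ = instantiate s σ ∧' instantiate t σ

  evaluate : ∀ {n} → Schema n → Vec Bool n → Bool
  evaluate (var i)  ρ = lookup ρ i
  evaluate (¬ₛ s)   ρ = not (evaluate s ρ)
  evaluate (s ∧ₛ t) ρ = evaluate s ρ ∧ evaluate t ρ

  peval-instantiate : ∀ {n} v (s : Schema n) σ →
                      peval v (instantiate s σ) ≡ evaluate s (mapᵛ (peval v) σ)
  peval-instantiate v (var i)  σ = sym (lookup-map i (peval v) σ)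
  peval-instantiate v (¬ₛ s)   σ = cong not (peval-instantiate v s σ)
  peval-instantiate v (s ∧ₛ t) σ =
    cong₂ _∧_ (peval-instantiate v s σ) (peval-instantiate v t σ)

  everyAssignment : ∀ n → (Vec Bool n → Bool) → Bool
  everyAssignment zero    g = g []
  everyAssignment (suc n) g = everyAssignment n (λ ρ → g (true ∷ ρ))
                            ∧ everyAssignment n (λ ρ → g (false ∷ ρ))

  everyAssignment-sound : ∀ n g → T (everyAssignment n g) → ∀ ρ → T (g ρ)
  everyAssignment-sound zero    g ok [] = ok
  everyAssignment-sound (suc n) g ok (true ∷ ρ) =
    everyAssignment-sound n _ (proj₁ (Equivalence.to T-∧ ok)) ρ
  everyAssignment-sound (suc n) g ok (false ∷ ρ) =
    everyAssignment-sound n _ (proj₂ (Equivalence.to T-∧ ok)) ρ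

  Valid : ∀ {n} → Schema n → Set
  Valid {n} s = T (everyAssignment n (evaluate s))

  -- Every instance of a valid schema is an instance of a tautology, hence a theorem.
  -- For a concrete schema the validity proof is found by evaluation.
  tautology : ∀ {n} (s : Schema n) (σ : Vec Form n) {valid : Valid s} → ⊢ instantiate s σ
  tautology s σ {valid} = PT λ v →
    trans (peval-instantiate v s σ)
          (Equivalence.to T-≡ (everyAssignment-sound _ _ valid (mapᵛ (peval v) σ)))

  ⊢⊤ : ⊢ ⊤'
  ⊢⊤ = tautology (⊤ₛ x₀) (atom 0 ∷ [])

  identity : ∀ {A} → ⊢ (A ⇒ A)
  identity {A} = tautology (x₀ ⇒ₛ x₀) (A ∷ [])

  weaken : ∀ {A B} → ⊢ (A ⇒ B ⇒ A)
  weaken {A} {B} = tautology (x₀ ⇒ₛ x₁ ⇒ₛ x₀) (A ∷ B ∷ [])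

  ∧-fst : ∀ {A B} → ⊢ (A ∧' B ⇒ A)
  ∧-fst {A} {B} = tautology (x₀ ∧ₛ x₁ ⇒ₛ x₀) (A ∷ B ∷ [])

  ∧-snd : ∀ {A B} → ⊢ (A ∧' B ⇒ B)
  ∧-snd {A} {B} = tautology (x₀ ∧ₛ x₁ ⇒ₛ x₁) (A ∷ B ∷ [])

  ∧-pair : ∀ {A B} → ⊢ (A ⇒ B ⇒ A ∧' B)
  ∧-pair {A} {B} = tautology (x₀ ⇒ₛ x₁ ⇒ₛ x₀ ∧ₛ x₁) (A ∷ B ∷ [])

  ⊤-left : ∀ {A} → ⊢ (A ⇒ ⊤' ∧' A)
  ⊤-left {A} = tautology (x₀ ⇒ₛ ⊤ₛ x₁ ∧ₛ x₀) (A ∷ atom 0 ∷ [])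

  ∧-reassoc : ∀ {A B C D} → ⊢ ((D ⇒ B ∧' C) ⇒ (A ∧' D ⇒ (A ∧' B) ∧' C))
  ∧-reassoc {A} {B} {C} {D} =
    tautology ((x₃ ⇒ₛ x₁ ∧ₛ x₂) ⇒ₛ (x₀ ∧ₛ x₃ ⇒ₛ (x₀ ∧ₛ x₁) ∧ₛ x₂)) (A ∷ B ∷ C ∷ D ∷ [])

  ∧-mp : ∀ {A B C X Y} → ⊢ ((C ⇒ X ∧' Y) ⇒ (X ⇒ A ⇒ B) ⇒ (Y ⇒ A) ⇒ (C ⇒ B))
  ∧-mp {A} {B} {C} {X} {Y} =
    tautology ((x₂ ⇒ₛ x₃ ∧ₛ x₄) ⇒ₛ (x₃ ⇒ₛ x₀ ⇒ₛ x₁) ⇒ₛ (x₄ ⇒ₛ x₀) ⇒ₛ (x₂ ⇒ₛ x₁))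
              (A ∷ B ∷ C ∷ X ∷ Y ∷ [])

  keep-hyp : ∀ {A C D P} → ⊢ ((C ∧' P ⇒ D) ⇒ ((A ∧' C) ∧' P ⇒ A ∧' D))
  keep-hyp {A} {C} {D} {P} =
    tautology ((x₁ ∧ₛ x₃ ⇒ₛ x₂) ⇒ₛ ((x₀ ∧ₛ x₁) ∧ₛ x₃ ⇒ₛ x₀ ∧ₛ x₂)) (A ∷ C ∷ D ∷ P ∷ [])

  use-hyp : ∀ {C D P} → ⊢ ((C ∧' P ⇒ D) ⇒ (C ∧' P ⇒ P ∧' D))
  use-hyp {C} {D} {P} = tautology ((x₀ ∧ₛ x₂ ⇒ₛ x₁) ⇒ₛ (x₀ ∧ₛ x₂ ⇒ₛ x₂ ∧ₛ x₁)) (C ∷ D ∷ P ∷ [])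

  exportation : ∀ {A B C D} → ⊢ ((C ∧' A ⇒ D) ⇒ (D ⇒ B) ⇒ (C ⇒ A ⇒ B))
  exportation {A} {B} {C} {D} =
    tautology ((x₂ ∧ₛ x₀ ⇒ₛ x₃) ⇒ₛ (x₃ ⇒ₛ x₁) ⇒ₛ (x₂ ⇒ₛ x₀ ⇒ₛ x₁)) (A ∷ B ∷ C ∷ D ∷ [])

  explosion : ∀ {A} → ⊢ (A ⇒ ¬' A ⇒ ⊥')
  explosion {A} = tautology (x₀ ⇒ₛ ¬ₛ x₀ ⇒ₛ ⊥ₛ x₁) (A ∷ atom 0 ∷ [])

  by-contradiction : ∀ {A} → ⊢ ((¬' A ⇒ ⊥') ⇒ A)
  by-contradiction {A} =
    tautology ((¬ₛ x₀ ⇒ₛ ⊥ₛ x₁) ⇒ₛ x₀) (A ∷ atom 0 ∷ [])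

  refutation : ∀ {A} → ⊢ ((A ⇒ ⊥') ⇒ ¬' A)
  refutation {A} = tautology ((x₀ ⇒ₛ ⊥ₛ x₁) ⇒ₛ ¬ₛ x₀) (A ∷ atom 0 ∷ [])

  double-negation : ∀ {A} → ⊢ (¬' (¬' A) ⇒ A)
  double-negation {A} = tautology (¬ₛ ¬ₛ x₀ ⇒ₛ x₀) (A ∷ [])

  contraposition : ∀ {A B} → ⊢ ((A ⇒ B) ⇒ (¬' B ⇒ ¬' A))
  contraposition {A} {B} = tautology ((x₀ ⇒ₛ x₁) ⇒ₛ (¬ₛ x₁ ⇒ₛ ¬ₛ x₀)) (A ∷ B ∷ [])

module Derivability (Agt : Set) (Λ : Syntax.Form Agt → Set) where
  open Syntax Agt
  open Logic Agt Λ
  open Schemata Agt Λ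

  infix 4 _⊩_

  -- Γ ⊩ φ: φ is derivable from finitely many members of Γ.
  -- By definition, Consistent Γ is ¬ (Γ ⊩ ⊥').
  _⊩_ : (Form → Set) → Form → Set
  Γ ⊩ φ = Σ (List Form) λ φs → All Γ φs × ⊢ (conj φs ⇒ φ)

  -- Γ ∪ {φ}, written as in the maximality clause of MCS.
  insert : Form → (Form → Set) → Form → Set
  insert φ Γ ψ = Γ ψ ⊎ ψ ≡ φ

  ⊩-mono : ∀ {Γ Δ : Form → Set} {φ} → (∀ {ψ} → Γ ψ → Δ ψ) → Γ ⊩ φ → Δ ⊩ φ
  ⊩-mono Γ⊆Δ (φs , φs∈Γ , d) = φs , mapᴬ Γ⊆Δ φs∈Γ , d

  consistent-antitone : ∀ {Γ Δ : Form → Set} → (∀ {ψ} → Γ ψ → Δ ψ) →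
                        Consistent Δ → Consistent Γ
  consistent-antitone Γ⊆Δ cons d = cons (⊩-mono Γ⊆Δ d)

  by-assumption : ∀ {Γ φ} → Γ φ → Γ ⊩ φ
  by-assumption g = _ ∷ [] , g ∷ [] , ∧-fst

  by-theorem : ∀ {Γ φ} → ⊢ φ → Γ ⊩ φ
  by-theorem d = [] , [] , MP weaken d

  conj-++ : ∀ xs ys → ⊢ (conj (xs ++ ys) ⇒ conj xs ∧' conj ys)
  conj-++ []       ys = ⊤-left
  conj-++ (x ∷ xs) ys = MP ∧-reassoc (conj-++ xs ys)

  ⊩-mp : ∀ {Γ φ ψ} → Γ ⊩ (φ ⇒ ψ) → Γ ⊩ φ → Γ ⊩ ψ
  ⊩-mp (xs , xs∈Γ , d) (ys , ys∈Γ , e) =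
    xs ++ ys , ++⁺ xs∈Γ ys∈Γ , MP (MP (MP ∧-mp (conj-++ xs ys)) d) e

  ⊩-by : ∀ {Γ φ ψ} → ⊢ (φ ⇒ ψ) → Γ ⊩ φ → Γ ⊩ ψ
  ⊩-by d = ⊩-mp (by-theorem d)

  discharge : ∀ {Γ φ} φs → All (insert φ Γ) φs →
              Σ (List Form) λ ψs → All Γ ψs × ⊢ (conj ψs ∧' φ ⇒ conj φs)
  discharge []       []                = [] , [] , ∧-fst
  discharge (x ∷ φs) (inj₁ x∈Γ ∷ rest) with discharge φs rest
  ... | ψs , ψs∈Γ , e = x ∷ ψs , x∈Γ ∷ ψs∈Γ , MP keep-hyp e
  discharge (x ∷ φs) (inj₂ refl ∷ rest) with discharge φs rest
  ... | ψs , ψs∈Γ , e = ψs , ψs∈Γ , MP use-hyp e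

  deduction : ∀ {Γ φ ψ} → insert φ Γ ⊩ ψ → Γ ⊩ (φ ⇒ ψ)
  deduction (φs , φs∈Γ+φ , d) with discharge φs φs∈Γ+φ
  ... | ψs , ψs∈Γ , e = ψs , ψs∈Γ , MP (MP exportation e) d

module MaximalConsistent (Agt : Set) (Λ : Syntax.Form Agt → Set)
                         {Γ : Syntax.Form Agt → Set} (mcs : Logic.MCS Agt Λ Γ) where
  open Syntax Agt
  open Logic Agt Λ
  open Schemata Agt Λ
  open Derivability Agt Λ

  closed : ∀ {φ} → Γ ⊩ φ → Γ φ
  closed {φ} d = proj₂ mcs φ λ d⊥ → proj₁ mcs (⊩-mp (deduction d⊥) d)

  provable : ∀ {φ} → ⊢ φ → Γ φ
  provable d = closed (by-theorem d)

  mp : ∀ {φ ψ} → Γ (φ ⇒ ψ) → Γ φ → Γ ψ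
  mp g h = closed (⊩-mp (by-assumption g) (by-assumption h))

  mp-by : ∀ {φ ψ} → ⊢ (φ ⇒ ψ) → Γ φ → Γ ψ
  mp-by d = mp (provable d)

  ∧-intro : ∀ {φ ψ} → Γ φ → Γ ψ → Γ (φ ∧' ψ)
  ∧-intro g h = mp (mp-by ∧-pair g) h

  ∧-elim : ∀ {φ ψ} → Γ (φ ∧' ψ) → Γ φ × Γ ψ
  ∧-elim g = mp-by ∧-fst g , mp-by ∧-snd g

  ¬-elim : ∀ {φ} → Γ (¬' φ) → ¬ Γ φ
  ¬-elim n g = proj₁ mcs (⊩-mp (⊩-by explosion (by-assumption g)) (by-assumption n))

  ¬-intro : ∀ {φ} → ¬ Γ φ → Γ (¬' φ)
  ¬-intro {φ} ng = proj₂ mcs (¬' φ) λ d⊥ → ng (closed (⊩-by by-contradiction (deduction d⊥)))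

  -- Membership is ¬¬-stable, so no excluded middle is needed to reason about Γ.
  stable : ∀ {φ} → ¬ ¬ Γ φ → Γ φ
  stable nng = mp-by double-negation (¬-intro λ n → nng (¬-elim n))

  -- Knowledge is closed under provable implication, by (K) and (NK).
  K-mono : ∀ {a φ ψ} → ⊢ (φ ⇒ ψ) → Γ (K a φ) → Γ (K a ψ)
  K-mono d k = mp (mp (provable AxK) (provable (NK d))) k

  K-closed : ∀ {a φ} → (λ χ → Γ (K a χ)) ⊩ φ → Γ (K a φ)
  K-closed {a} (ψs , known , d) = K-mono d (K-conj ψs known)
    where
    K-conj : ∀ ψs → All (λ χ → Γ (K a χ)) ψs → Γ (K a (conj ψs))
    K-conj []       []       = provable (NK ⊢⊤)
    K-conj (ψ ∷ ψs) (k ∷ ks) = mp (mp (provable AxK) (K-mono ∧-pair k)) (K-conj ψs ks)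

  -- Ignorance of a Ky-fact is known: from (4YKR) by contraposition, with (T) and (5).
  Ky-negative-introspection : ∀ {a φ ψ} → Γ (¬' (Ky a φ ψ)) → Γ (K a (¬' (Ky a φ ψ)))
  Ky-negative-introspection n =
    K-mono (MP contraposition 4YKR)
           (mp (provable Ax5) (¬-intro λ k → ¬-elim n (mp (provable AxT) k)))

-- An injective pairing ⟨ m , n ⟩ = 2ᵐ(2n+1) on ℕ.
module Pairing where
  double : ℕ → ℕ
  double zero    = zero
  double (suc n) = suc (suc (double n))

  double-injective : ∀ {m n} → double m ≡ double n → m ≡ n
  double-injective {zero}  {zero}  eq = refl
  double-injective {suc m} {suc n} eq =
    cong suc (double-injective (suc-injective (suc-injective eq)))

  odd≢even : ∀ m n → suc (double m) ≢ double n
  odd≢even (suc m) (suc n) eq = odd≢even m n (suc-injective (suc-injective eq))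

  -- Opaque, so that equations between codes keep their pair structure.
  opaque
    ⟨_,_⟩ : ℕ → ℕ → ℕ
    ⟨ zero  , n ⟩ = suc (double n)
    ⟨ suc m , n ⟩ = double ⟨ m , n ⟩

    pair-injective : ∀ {m n m′ n′} → ⟨ m , n ⟩ ≡ ⟨ m′ , n′ ⟩ → m ≡ m′ × n ≡ n′
    pair-injective {zero}  {n} {zero}   eq = refl , double-injective (suc-injective eq)
    pair-injective {zero}  {n} {suc m′} eq = ⊥-elim (odd≢even n _ eq)
    pair-injective {suc m} {n} {zero} {n′} eq = ⊥-elim (odd≢even n′ _ (sym eq))
    pair-injective {suc m} {n} {suc m′} eq with pair-injective {m} {n} {m′} (double-injective eq)
    ... | refl , refl = refl , refl

module FormulaCoding (Agt : Set) (ι : Agt ↣ ℕ) where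
  open Syntax Agt
  open Pairing

  agent : Agt → ℕ
  agent = Injection.to ι

  code : Form → ℕ
  code (atom p)   = ⟨ 0 , p ⟩
  code (¬' φ)     = ⟨ 1 , code φ ⟩
  code (φ ∧' ψ)   = ⟨ 2 , ⟨ code φ , code ψ ⟩ ⟩
  code (K a φ)    = ⟨ 3 , ⟨ agent a , code φ ⟩ ⟩
  code (Ky a φ ψ) = ⟨ 4 , ⟨ agent a , ⟨ code φ , code ψ ⟩ ⟩ ⟩

  code-injective : ∀ φ ψ → code φ ≡ code ψ → φ ≡ ψ
  code-injective (atom p) (atom q) eq with pair-injective eq
  ... | _ , refl = refl
  code-injective (¬' φ) (¬' ψ) eq with pair-injective eq
  ... | _ , e with code-injective φ ψ e
  ... | refl = refl
  code-injective (φ ∧' φ′) (ψ ∧' ψ′) eq with pair-injective (proj₂ (pair-injective eq))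
  ... | e , e′ with code-injective φ ψ e | code-injective φ′ ψ′ e′
  ... | refl | refl = refl
  code-injective (K a φ) (K b ψ) eq with pair-injective (proj₂ (pair-injective eq))
  ... | e , e′ with Injection.injective ι e | code-injective φ ψ e′
  ... | refl | refl = refl
  code-injective (Ky a φ φ′) (Ky b ψ ψ′) eq with pair-injective (proj₂ (pair-injective eq))
  ... | e , e′ with pair-injective e′
  ... | e₁ , e₂ with Injection.injective ι e | code-injective φ ψ e₁ | code-injective φ′ ψ′ e₂
  ... | refl | refl | refl = refl
  code-injective (atom _)   (¬' _)     eq with () ← proj₁ (pair-injective eq)
  code-injective (atom _)   (_ ∧' _)   eq with () ← proj₁ (pair-injective eq)
  code-injective (atom _)   (K _ _)    eq with () ← proj₁ (pair-injective eq)
  code-injective (atom _)   (Ky _ _ _) eq with () ← proj₁ (pair-injective eq)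
  code-injective (¬' _)     (atom _)   eq with () ← proj₁ (pair-injective eq)
  code-injective (¬' _)     (_ ∧' _)   eq with () ← proj₁ (pair-injective eq)
  code-injective (¬' _)     (K _ _)    eq with () ← proj₁ (pair-injective eq)
  code-injective (¬' _)     (Ky _ _ _) eq with () ← proj₁ (pair-injective eq)
  code-injective (_ ∧' _)   (atom _)   eq with () ← proj₁ (pair-injective eq)
  code-injective (_ ∧' _)   (¬' _)     eq with () ← proj₁ (pair-injective eq)
  code-injective (_ ∧' _)   (K _ _)    eq with () ← proj₁ (pair-injective eq)
  code-injective (_ ∧' _)   (Ky _ _ _) eq with () ← proj₁ (pair-injective eq)
  code-injective (K _ _)    (atom _)   eq with () ← proj₁ (pair-injective eq)
  code-injective (K _ _)    (¬' _)     eq with () ← proj₁ (pair-injective eq)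
  code-injective (K _ _)    (_ ∧' _)   eq with () ← proj₁ (pair-injective eq)
  code-injective (K _ _)    (Ky _ _ _) eq with () ← proj₁ (pair-injective eq)
  code-injective (Ky _ _ _) (atom _)   eq with () ← proj₁ (pair-injective eq)
  code-injective (Ky _ _ _) (¬' _)     eq with () ← proj₁ (pair-injective eq)
  code-injective (Ky _ _ _) (_ ∧' _)   eq with () ← proj₁ (pair-injective eq)
  code-injective (Ky _ _ _) (K _ _)    eq with () ← proj₁ (pair-injective eq)

module Lindenbaum (Agt : Set) (ι : Agt ↣ ℕ) (Λ : Syntax.Form Agt → Set)
                  (S : Syntax.Form Agt → Set) (S-consistent : Logic.Consistent Agt Λ S) where
  open Syntax Agt
  open Logic Agt Λ
  open Derivability Agt Λ
  open FormulaCoding Agt ι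

  -- Stage n has settled every formula with code below n.
  stage : ℕ → Form → Set
  stage zero    = S
  stage (suc n) χ = stage n χ ⊎ (code χ ≡ n × Consistent (insert χ (stage n)))

  Δ : Form → Set
  Δ χ = Σ ℕ λ n → stage n χ

  S⊆Δ : ∀ {χ} → S χ → Δ χ
  S⊆Δ s = 0 , s

  stage-mono : ∀ {m n χ} → m ≤′ n → stage m χ → stage n χ
  stage-mono (≤′-reflexive refl) s = s
  stage-mono (≤′-step m≤n)       s = inj₁ (stage-mono m≤n s)

  common-stage : ∀ φs → All Δ φs → Σ ℕ λ n → All (stage n) φs
  common-stage []       []                  = 0 , []
  common-stage (φ ∷ φs) ((m , φ∈stage) ∷ rest) with common-stage φs rest
  ... | n , φs∈stage = m ⊔ n , stage-mono (≤⇒≤′ (m≤m⊔n m n)) φ∈stage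
                             ∷ mapᴬ (stage-mono (≤⇒≤′ (m≤n⊔m m n))) φs∈stage

  -- By injectivity of the coding, stage n + 1 adds at most the formula coded n.
  added-unique : ∀ {n χ ψ} → code χ ≡ n → stage (suc n) ψ → insert χ (stage n) ψ
  added-unique c (inj₁ ψ∈stage)  = inj₁ ψ∈stage
  added-unique c (inj₂ (c′ , _)) = inj₂ (code-injective _ _ (trans c′ (sym c)))

  new-or-old : ∀ {n} φs → All (stage (suc n)) φs →
               All (stage n) φs ⊎ Σ Form λ χ → code χ ≡ n × Consistent (insert χ (stage n))
  new-or-old []       []                    = inj₁ []
  new-or-old (φ ∷ φs) (inj₂ added ∷ _)      = inj₂ (φ , added)
  new-or-old (φ ∷ φs) (inj₁ φ∈stage ∷ rest) with new-or-old φs rest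
  ... | inj₁ old   = inj₁ (φ∈stage ∷ old)
  ... | inj₂ added = inj₂ added

  -- Every stage is consistent: a derivation of ⊥' from stage n + 1 lives either in
  -- stage n or in the consistent extension that produced stage n + 1.
  stage-consistent : ∀ n → Consistent (stage n)
  stage-consistent zero = S-consistent
  stage-consistent (suc n) (φs , φs∈stage , d) with new-or-old φs φs∈stage
  ... | inj₁ old             = stage-consistent n (φs , old , d)
  ... | inj₂ (χ , c , cons) = cons (φs , mapᴬ (added-unique c) φs∈stage , d)

  -- Δ is consistent by compactness, and maximal because stage (code φ) + 1 decides φ.
  Δ-mcs : MCS Δ
  Δ-mcs = consistent , maximal
    where
    consistent : Consistent Δ
    consistent (φs , φs∈Δ , d) with common-stage φs φs∈Δ
    ... | n , φs∈stage = stage-consistent n (φs , φs∈stage , d)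

    maximal : ∀ φ → Consistent (insert φ Δ) → Δ φ
    maximal φ cons = suc (code φ) , inj₂ (refl , consistent-antitone into-Δ cons)
      where
      into-Δ : ∀ {ψ} → insert φ (stage (code φ)) ψ → insert φ Δ ψ
      into-Δ (inj₁ ψ∈stage) = inj₁ (code φ , ψ∈stage)
      into-Δ (inj₂ ψ≡φ)     = inj₂ ψ≡φ

module CanonicalModel (Agt : Set) (ι : Agt ↣ ℕ) (Λ : Syntax.Form Agt → Set) where
  open Syntax Agt
  open Logic Agt Λ
  open Canonical Agt Λ
  open Schemata Agt Λ using (⊢⊤; identity; ∧-fst; double-negation; refutation)
  open Derivability Agt Λ

  Avoids : Form → Term → Set
  Avoids χ e       = ⊤
  Avoids χ (fm φ)  = φ ≢ χ
  Avoids χ (t · s) = Avoids χ t × Avoids χ s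

  -- The number of symbols of a formula; a leaf of t is no larger than leaves t.
  size : Form → ℕ
  size (atom p)   = 1
  size (¬' φ)     = suc (size φ)
  size (φ ∧' ψ)   = suc (size φ + size ψ)
  size (K a φ)    = suc (size φ)
  size (Ky a φ ψ) = suc (size φ + size ψ)

  leaves : Term → Form
  leaves e       = ⊤'
  leaves (fm φ)  = φ
  leaves (t · s) = leaves t ∧' leaves s

  avoids-larger : ∀ t χ → size (leaves t) < size χ → Avoids χ t
  avoids-larger e       χ _ = _
  avoids-larger (fm φ)  χ small refl = <-irrefl refl small
  avoids-larger (t · s) χ small =
    avoids-larger t χ (<-trans (s≤s (m≤m+n (size (leaves t)) (size (leaves s)))) small) ,
    avoids-larger s χ (<-trans (s≤s (m≤n+m (size (leaves s)) (size (leaves t)))) small)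

  fresh : Term → Form
  fresh t = ¬' (leaves t)

  fresh-avoids : ∀ t → Avoids (fresh t) t
  fresh-avoids t = avoids-larger t (fresh t) ≤-refl

  -- Its evidence functions are those of w for agent a
  -- and label the formula χ₀ for other agents; evidence in v whose term avoids χ₀
  -- is therefore backed by Ky_a-formulas of w.
  module Successor (w : World) (a : Agt) (θ : Form) (θ-possible : ¬ Γ w (K a (¬' θ)))
                   (χ₀ : Form) where
    private module W = MaximalConsistent Agt Λ (mcs w)

    known : Form → Set
    known χ = Γ w (K a χ)

    -- Inconsistency of the seed would make a know ¬θ.
    seed-consistent : Consistent (insert θ known)
    seed-consistent d = θ-possible (W.K-closed (⊩-by refutation (deduction d)))

    open Lindenbaum Agt ι Λ (insert θ known) seed-consistent using (Δ; Δ-mcs; S⊆Δ)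
    private module D = MaximalConsistent Agt Λ Δ-mcs

    -- Ky_a-formulas are shared between w and v, by positive and negative introspection.
    Ky-down : ∀ {φ ψ} → Γ w (Ky a φ ψ) → Δ (Ky a φ ψ)
    Ky-down g = S⊆Δ (inj₁ (W.mp (W.provable 4YKR) g))

    Ky-up : ∀ {φ ψ} → Δ (Ky a φ ψ) → Γ w (Ky a φ ψ)
    Ky-up k = W.stable λ ng →
      D.¬-elim (S⊆Δ (inj₁ (W.Ky-negative-introspection (W.¬-intro ng)))) k

    evidence : (b : Agt) (φ ψ : Form) → .(Δ (Ky b φ ψ)) → Ev
    evidence b φ ψ k with eq? ι b a
    ... | yes refl = f w a φ ψ (Ky-up k)
    ... | no _     = evF χ₀ φ

    evidence-label : ∀ b φ ψ (k : Δ (Ky b φ ψ)) → label (evidence b φ ψ k) ≡ φ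
    evidence-label b φ ψ k with eq? ι b a
    ... | yes refl = c4 w a φ ψ (Ky-up k)
    ... | no _     = refl

    -- The least evidence relation satisfying conditions (1)-(3) of a world.
    data Admissible : Ev → Form → Set where
      ground   : ∀ {φ} → Λ φ → Admissible e⊤ φ
      assigned : ∀ b φ ψ (k : Δ (Ky b φ ψ)) → Δ (Ky b φ ψ ∧' φ) →
                 Admissible (evidence b φ ψ k) ψ
      apply    : ∀ {s r φ ψ} → Admissible s (φ ⇒ ψ) → Admissible r φ → Admissible (s ∙ r) ψ

    v : World
    v = record { Γ = Δ ; mcs = Δ-mcs ; F = Admissible ; f = evidence
               ; c1 = λ _ _ _ _ → apply ; c2 = λ _ → ground
               ; c3 = assigned ; c4 = evidence-label }

    w-R-v : R a w v
    w-R-v = (λ _ → S⊆Δ ∘′ inj₁) , (λ _ _ → Ky-down , Ky-up) , same-evidence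
      where
      same-evidence : ∀ φ ψ (g : Γ w (Ky a φ ψ)) (k : Δ (Ky a φ ψ)) → f w a φ ψ g ≡ evidence a φ ψ k
      same-evidence φ ψ g k with eq? ι a a
      ... | yes refl = refl
      ... | no a≢a   = ⊥-elim (a≢a refl)

    θ∈v : Δ θ
    θ∈v = S⊆Δ (inj₂ refl)

    evidence-origin : ∀ {s χ} → Avoids χ₀ (term s) → Admissible s χ →
                      Γ w (Ky a (label s) χ) × Δ (label s)
    evidence-origin _ (ground λχ) = W.provable (NKyR λχ) , D.provable ⊢⊤
    evidence-origin avoids (assigned b φ ψ k k∧φ) with eq? ι b a
    ... | yes refl = subst (λ ℓ → Γ w (Ky a ℓ ψ) × Δ ℓ) (sym (c4 w a φ ψ (Ky-up k)))
                           (Ky-up k , proj₂ (D.∧-elim k∧φ))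
    ... | no _     = ⊥-elim (avoids refl)
    evidence-origin (avoids-s , avoids-r) (apply s-ev r-ev)
      with evidence-origin avoids-s s-ev | evidence-origin avoids-r r-ev
    ... | Ky-s , ℓs∈Δ | Ky-r , ℓr∈Δ =
      W.mp (W.mp (W.provable EKyR) Ky-s) Ky-r , D.∧-intro ℓs∈Δ ℓr∈Δ

  TruthLemma : Form → Set₁
  TruthLemma φ = ∀ w → (w ⊨ φ → Γ w φ) × (Γ w φ → w ⊨ φ)

  truth-¬ : ∀ {φ} → TruthLemma φ → TruthLemma (¬' φ)
  truth-¬ tφ w = (λ ⊭φ → W.¬-intro λ φ∈w → ⊭φ (proj₂ (tφ w) φ∈w))
               , (λ ¬φ∈w ⊨φ → W.¬-elim ¬φ∈w (proj₁ (tφ w) ⊨φ))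
    where module W = MaximalConsistent Agt Λ (mcs w)

  truth-∧ : ∀ {φ ψ} → TruthLemma φ → TruthLemma ψ → TruthLemma (φ ∧' ψ)
  truth-∧ tφ tψ w = (λ (⊨φ , ⊨ψ) → W.∧-intro (proj₁ (tφ w) ⊨φ) (proj₁ (tψ w) ⊨ψ))
                  , (λ φψ∈w → let φ∈w , ψ∈w = W.∧-elim φψ∈w
                              in proj₂ (tφ w) φ∈w , proj₂ (tψ w) ψ∈w)
    where module W = MaximalConsistent Agt Λ (mcs w)

  truth-K : ∀ {a φ} → TruthLemma φ → TruthLemma (K a φ)
  truth-K {a} {φ} tφ w = complete , sound
    where
    module W = MaximalConsistent Agt Λ (mcs w)

    sound : Γ w (K a φ) → w ⊨ K a φ
    sound k v (K⊆ , _) = proj₂ (tφ v) (K⊆ φ k)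

    -- If K_a φ ∉ Γ w, then ¬φ is possible for a, and a successor containing ¬φ refutes φ.
    complete : w ⊨ K a φ → Γ w (K a φ)
    complete ⊨Kφ = W.stable λ ng →
      let open Successor w a (¬' φ) (λ k → ng (W.K-mono double-negation k)) ⊤'
      in MaximalConsistent.¬-elim Agt Λ (mcs v) θ∈v (proj₁ (tφ v) (⊨Kφ v w-R-v))

  evidence-pullback : ∀ {a φ ψ} → TruthLemma φ → ∀ w → (⊨Ky : w ⊨ Ky a φ ψ) →
                      ∀ θ → ⊢ (θ ⇒ φ) → ¬ Γ w (K a (¬' θ)) →
                      Γ w (Ky a (label (proj₁ ⊨Ky)) ψ) ×
                      Σ World λ v → Γ v θ × Γ v (label (proj₁ ⊨Ky))
  evidence-pullback {a} tφ w (t , works) θ θ⇒φ θ-possible =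
    let open Successor w a θ θ-possible (fresh (term t))
        v⊨φ = proj₂ (tφ v) (MaximalConsistent.mp-by Agt Λ (mcs v) θ⇒φ θ∈v)
        t-for-ψ = lower (proj₁ (works v w-R-v v⊨φ))
        Ky∈w , ℓ∈v = evidence-origin (fresh-avoids (term t)) t-for-ψ
    in Ky∈w , v , θ∈v , ℓ∈v

  truth-Ky : ∀ {a φ ψ} → TruthLemma φ → TruthLemma ψ → TruthLemma (Ky a φ ψ)
  truth-Ky {a} {φ} {ψ} tφ tψ w = complete , sound
    where
    module W = MaximalConsistent Agt Λ (mcs w)

    -- The evidence assigned by f, which successors share, works by condition (3);
    -- ψ holds there by (DKyR).
    sound : Γ w (Ky a φ ψ) → w ⊨ Ky a φ ψ
    sound Ky∈w = f w a φ ψ Ky∈w , λ v (K⊆ , Ky-shared , f-shared) v⊨φ →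
      let module V = MaximalConsistent Agt Λ (mcs v)
          φ∈v  = proj₁ (tφ v) v⊨φ
          Ky∈v = proj₁ (Ky-shared φ ψ) Ky∈w
      in lift (subst (λ t → F v t ψ) (sym (f-shared φ ψ Ky∈w Ky∈v))
                     (c3 v a φ ψ Ky∈v (V.∧-intro Ky∈v φ∈v)))
       , proj₂ (tψ v) (V.mp (K⊆ _ (W.mp (W.provable DKyR) Ky∈w)) φ∈v)

    -- Suppose Ky_a(φ, ψ) ∉ Γ w, with evidence label ℓ. By (UKyR) φ is possible for a,
    -- so Ky_a(ℓ, ψ) ∈ Γ w; by (IKyR) then φ ∧ ¬ℓ is possible, yet ℓ holds wherever
    -- the evidence does.
    complete : w ⊨ Ky a φ ψ → Γ w (Ky a φ ψ)
    complete ⊨Ky = W.stable λ Ky∉w →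
      let Ky-ℓ , _ = evidence-pullback tφ w ⊨Ky φ identity
                       (λ k → Ky∉w (W.mp (W.provable UKyR) k))
          _ , v , φ∧¬ℓ∈v , ℓ∈v = evidence-pullback tφ w ⊨Ky (φ ∧' ¬' (label (proj₁ ⊨Ky))) ∧-fst
                                   (λ k → Ky∉w (W.mp (W.mp (W.provable IKyR) Ky-ℓ) k))
          module V = MaximalConsistent Agt Λ (mcs v)
      in V.¬-elim (proj₂ (V.∧-elim φ∧¬ℓ∈v)) ℓ∈v

  truth : ∀ φ → TruthLemma φ
  truth (atom p)   w = lower , lift
  truth (¬' φ)       = truth-¬ (truth φ)
  truth (φ ∧' ψ)     = truth-∧ (truth φ) (truth ψ)
  truth (K a φ)      = truth-K (truth φ)
  truth (Ky a φ ψ)   = truth-Ky (truth φ) (truth ψ)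

-- Lemma 3.25 (truth lemma).
lemma3p25 : ExcludedMiddle 0ℓ →
            (Agt : Set) → Agt ↣ ℕ →
            (Λ : Syntax.Form Agt → Set) →
            (φ : Syntax.Form Agt) (w : Canonical.World Agt Λ) →
            (Canonical._⊨_ Agt Λ w φ → Canonical.Γ w φ) ×
            (Canonical.Γ w φ → Canonical._⊨_ Agt Λ w φ)
lemma3p25 _ Agt ι Λ φ = CanonicalModel.truth Agt ι Λ φ
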